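{- Let $a,b$ be positive integers and write $a=tb+r$ with integers $t\ge 0$ and $0\le r<b$. Let $\Delta$ be the regular configuration in $\mathrm{CONF}(a,b)$ with characteristic sequence $\{x_0,\dots,x_{b-1}\}$, and let $\Delta'\in\mathrm{CONF}(r,b)$ be the configuration characterized by $\{x'_0,\dots,x'_{b-1}\}$, where $x'_j=x_j-t$. Then $\Delta'$ is regular and $|\mathrm{Rot}(\Delta)|=|\mathrm{Rot}(\Delta')|$.
   Context: $\mathrm{CONF}(a,b)$ is the set of necklaces (circular arrangements up to rotation) of $a$ red and $b$ black beads. A sequence $\{x_0,\dots,x_{b-1}\}$ of nonnegative integers with sum $a$ characterizes the necklace in which black beads $B_0,\dots,B_{b-1}$ appear in cyclic order with $x_i$ red beads between $B_i$ and $B_{i+1}$ (indices mod $b$); this is its characteristic sequence, defined up to cyclic shift. The necklace is regular if $\frac{a}{b}k-1<x_i+\dots+x_{i+k-1}<\frac{a}{b}k+1$ for all $0\le i\le b-1$ and $1\le k\le 1+\lfloor b/2\rfloor$ (indices mod $b$). There is a unique regular configuration in $\mathrm{CONF}(a,b)$. For a necklace $\Delta$ with $n$ beads labelled consecutively $0,\dots,n-1$, where $t_i$ denotes bead $i$, $\mathrm{Rot}(\Delta)$ is the group of rotations $\phi_k(i)=i+k \bmod n$ such that $t_i$ and $t_{\phi_k(i)}$ have the same color for all $i$. Its size is independent of the labelling. -}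

module Defs where

open import Data.Bool using (Bool; true; false)
open import Data.Nat using (ℕ; zero; suc; _+_; _*_; _/_; _<_; _≤_; NonZero)
open import Data.Nat.DivMod using (_%_; m%n<n)
open import Data.Nat.Properties using (_≤?_)
open import Data.Fin using (Fin; fromℕ<)
open import Data.List using (List; []; _∷_; _++_; replicate; concatMap; allFin; map; upTo; drop; take; length; filter)
open import Data.List.Properties using (≡-dec)
open import Data.Nat.ListAction using (sum)
open import Data.Product using (_×_)
import Data.Bool.Properties as BoolP
open import Relation.Nullary using (Dec)
open import Relation.Binary.PropositionalEquality using (_≡_)

-- Characteristic sequences: x : Fin b → ℕ, x i = number of red beads
-- between black bead B_i and B_{i+1} (indices mod b).

charSum : {b : ℕ} → (Fin b → ℕ) → ℕ
charSum {b} x = sum (map x (allFin b))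

idx : (b : ℕ) .{{_ : NonZero b}} → ℕ → Fin b
idx b m = fromℕ< (m%n<n m b)

windowSum : (b : ℕ) .{{_ : NonZero b}} → (Fin b → ℕ) → ℕ → ℕ → ℕ
windowSum b x i k = sum (map (λ m → x (idx b (i + m))) (upTo k))

-- Regularity of the necklace in CONF(a,b) with characteristic sequence x:
-- (a/b)k - 1 < S < (a/b)k + 1  (S the window sum), multiplied through by b > 0:
-- a*k < b*S + b  and  b*S < a*k + b,
-- for all 0 ≤ i ≤ b-1 and 1 ≤ k ≤ 1 + ⌊b/2⌋.
Regular : (a b : ℕ) .{{_ : NonZero b}} → (Fin b → ℕ) → Set
Regular a b x =
  (i k : ℕ) → i < b → 1 ≤ k → k ≤ 1 + (b / 2) →
    (a * k < b * windowSum b x i k + b) × (b * windowSum b x i k < a * k + b)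

-- The bead word of the necklace: B_0, x_0 reds, B_1, x_1 reds, ..., B_{b-1}, x_{b-1} reds.
-- Colours: true = red, false = black.  Beads labelled 0..n-1 consecutively.
necklace : (b : ℕ) → (Fin b → ℕ) → List Bool
necklace b x = concatMap (λ i → false ∷ replicate (x i) true) (allFin b)

rotate : ℕ → List Bool → List Bool
rotate k w = drop k w ++ take k w

-- φ_k ∈ Rot(Δ)  iff  t_i and t_{i+k mod n} have the same colour for all i,
-- i.e. iff the word is invariant under rotation by k.
rotInvariant? : (w : List Bool) (k : ℕ) → Dec (rotate k w ≡ w)
rotInvariant? w k = ≡-dec BoolP._≟_ (rotate k w) w

rotCount : List Bool → ℕ
rotCount w = length (filter (rotInvariant? w) (upTo (length w)))

module Submission where

-- Write t = a / b and r = a % b, so that a = r + t·b, and let x'_j = x_j - t.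
--
-- 1. Gaps are at least t: the regularity window of length 1 at B_j gives
--    a < b·(x_j + 1), while t·b ≤ a, hence t < x_j + 1.
-- 2. Lowering each of n summands by t lowers a sum by n·t.  Applied to the whole
--    sequence this gives Σ x' = a - t·b = r; applied to a window of length k it
--    gives S' = S - k·t, and both regularity inequalities for (a, b, x) turn into
--    those for (r, b, x') after cancelling t·b·k on both sides.
-- 3. Rotational symmetry of the bead word of a sequence ys (blocks B R^{y}) is read
--    off the sequence itself: a rotation starting at a red bead cannot fix a word
--    beginning with a black bead, and the rotation to the j-th black bead turns the
--    word of ys into the word of ys rotated by j.  As the bead word determines ys,
--    |Rot| is the number of j < length ys with ys rotated by j equal to ys.
-- 4. Subtracting t entrywise is undone by adding t back (all entries are ≥ t) and
--    commutes with rotation, so ys and x' have the same rotational symmetries.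

open import Defs
open import Data.Nat using (ℕ; zero; suc; _+_; _*_; _∸_; _/_; _%_; _<_; _≤_; _≟_; z≤n; s≤s; NonZero)
open import Data.Nat.Properties
open import Data.Nat.DivMod using (m≡m%n+[m/n]*n; m<n⇒m%n≡m; m/n*n≤m; m%n<n)
open import Data.Nat.ListAction using (sum)
open import Data.Nat.Tactic.RingSolver using (solve-∀)
open import Data.Fin using (Fin; toℕ)
open import Data.Fin.Properties using (toℕ<n; toℕ-fromℕ<; toℕ-injective)
open import Data.Bool using (Bool; true; false)
open import Data.Maybe using (just)
open import Data.List
  using (List; []; _∷_; _++_; [_]; map; length; upTo; applyUpTo; allFin; replicate; drop; take; filter; head; concatMap)
open import Data.List.Properties
  using (length-upTo; length-tabulate; length-map; length-++; length-replicate; map-∘; map-++; map-id-local;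
         drop-map; take-map; filter-++; filter-≐; ++-assoc; ++-identityʳ; ∷-injectiveʳ;
         concatMap-map; concatMap-++; ≡-dec)
open import Data.List.Relation.Unary.All using (universal)
import Data.List.Relation.Unary.All.Properties as All
open import Data.Product using (_×_; _,_; proj₁; proj₂; map₁)
open import Data.Empty using (⊥-elim)
open import Function using (id; _⇔_; mk⇔; Equivalence)
open import Relation.Nullary using (¬_; yes; no)
open import Relation.Unary using (Decidable)
open import Relation.Binary.PropositionalEquality
  using (_≡_; _≢_; refl; sym; trans; cong; cong₂; subst; subst₂; module ≡-Reasoning)

sum-map-∸ : ∀ {A : Set} (f : A → ℕ) (t : ℕ) → (∀ a → t ≤ f a) → (L : List A) →
  sum (map (λ a → f a ∸ t) L) + length L * t ≡ sum (map f L)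
sum-map-∸ f t t≤f [] = refl
sum-map-∸ f t t≤f (a ∷ L) = begin
  (f a ∸ t + S') + (t + length L * t) ≡⟨ regroup (f a ∸ t) S' (length L) t ⟩
  (f a ∸ t + t) + (S' + length L * t) ≡⟨ cong₂ _+_ (m∸n+n≡m (t≤f a)) (sum-map-∸ f t t≤f L) ⟩
  f a + sum (map f L)                 ∎
  where
  open ≡-Reasoning
  S' = sum (map (λ a → f a ∸ t) L)
  regroup : ∀ u s n t → (u + s) + (t + n * t) ≡ (u + t) + (s + n * t)
  regroup = solve-∀

charSum-∸ : ∀ {b} (x : Fin b → ℕ) (t : ℕ) → (∀ j → t ≤ x j) →
  charSum (λ j → x j ∸ t) + b * t ≡ charSum x
charSum-∸ {b} x t t≤x =
  trans (cong (λ n → charSum (λ j → x j ∸ t) + n * t) (sym (length-tabulate {n = b} id)))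
        (sum-map-∸ x t t≤x (allFin b))

windowSum-∸ : ∀ b .{{_ : NonZero b}} (x : Fin b → ℕ) (t : ℕ) → (∀ j → t ≤ x j) → ∀ i k →
  windowSum b (λ j → x j ∸ t) i k + k * t ≡ windowSum b x i k
windowSum-∸ b x t t≤x i k =
  trans (cong (λ n → windowSum b (λ j → x j ∸ t) i k + n * t) (sym (length-upTo k)))
        (sum-map-∸ (λ m → x (idx b (i + m))) t (λ m → t≤x _) (upTo k))

windowSum-single : ∀ b .{{_ : NonZero b}} (x : Fin b → ℕ) (j : Fin b) →
  windowSum b x (toℕ j) 1 ≡ x j
windowSum-single b x j = trans (+-identityʳ _) (cong x idx-j)
  where
  idx-j : idx b (toℕ j + 0) ≡ j
  idx-j = toℕ-injective (trans (toℕ-fromℕ< (m%n<n (toℕ j + 0) b))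
            (trans (cong (_% b) (+-identityʳ (toℕ j))) (m<n⇒m%n≡m (toℕ<n j))))

-- In a regular necklace of CONF(a, b) every gap holds at least ⌊a/b⌋ red beads:
-- the window of length 1 at B_j gives a < b·(x_j + 1), while ⌊a/b⌋·b ≤ a.
regular⇒quotient≤gap : ∀ a b .{{_ : NonZero b}} (x : Fin b → ℕ) → Regular a b x →
  (j : Fin b) → a / b ≤ x j
regular⇒quotient≤gap a b x reg j = m<1+n⇒m≤n (*-cancelʳ-< b (a / b) (suc (x j)) t·b<[x+1]·b)
  where
  window : a * 1 < b * windowSum b x (toℕ j) 1 + b
  window = proj₁ (reg (toℕ j) 1 (toℕ<n j) (s≤s z≤n) (s≤s z≤n))
  a<[x+1]·b : a < suc (x j) * b
  a<[x+1]·b = subst₂ _<_ (*-identityʳ a)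
    (trans (cong (λ s → b * s + b) (windowSum-single b x j)) (trans (+-comm _ b) (cong (b +_) (*-comm b (x j)))))
    window
  t·b<[x+1]·b : a / b * b < suc (x j) * b
  t·b<[x+1]·b = ≤-<-trans (m/n*n≤m a b) a<[x+1]·b

-- Removing t red beads from every gap sends regular necklaces of CONF(r + t·b, b)
-- to regular necklaces of CONF(r, b): with S = S' + k·t, both window inequalities
-- just gain the summand t·b·k on each side.
regular-∸ : ∀ r t b .{{_ : NonZero b}} (x : Fin b → ℕ) → (∀ j → t ≤ x j) →
  Regular (r + t * b) b x → Regular r b (λ j → x j ∸ t)
regular-∸ r t b x t≤x reg i k i<b 1≤k k≤ = lower , upper
  where
  S' = windowSum b (λ j → x j ∸ t) i k
  S≡ : windowSum b x i k ≡ S' + k * t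
  S≡ = sym (windowSum-∸ b x t t≤x i k)
  expand-a : ∀ r t b k → (r + t * b) * k ≡ r * k + t * b * k
  expand-a = solve-∀
  expand-bS : ∀ b S' k t → b * (S' + k * t) ≡ b * S' + t * b * k
  expand-bS = solve-∀
  swap-last : ∀ u v e → u + e + v ≡ u + v + e
  swap-last = solve-∀
  window = reg i k i<b 1≤k k≤
  lower : r * k < b * S' + b
  lower = +-cancelʳ-< (t * b * k) (r * k) (b * S' + b) (subst₂ _<_ (expand-a r t b k)
    (trans (cong (λ S → b * S + b) S≡) (trans (cong (_+ b) (expand-bS b S' k t)) (swap-last (b * S') b (t * b * k))))
    (proj₁ window))
  upper : b * S' < r * k + b
  upper = +-cancelʳ-< (t * b * k) (b * S') (r * k + b) (subst₂ _<_
    (trans (cong (b *_) S≡) (expand-bS b S' k t))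
    (trans (cong (_+ b) (expand-a r t b k)) (swap-last (r * k) b (t * b * k)))
    (proj₂ window))

block : ℕ → List Bool
block y = false ∷ replicate y true

beadWord : List ℕ → List Bool
beadWord = concatMap block

necklace-beadWord : ∀ b (x : Fin b → ℕ) → necklace b x ≡ beadWord (map x (allFin b))
necklace-beadWord b x = sym (concatMap-map block x (allFin b))

StartsRed : List Bool → Set
StartsRed w = head w ≡ just true

startsRed-++ : ∀ u v → StartsRed u → StartsRed (u ++ v)
startsRed-++ (c ∷ u) v red = red

startsRed-drop-reds : ∀ {i z} R → i < z → StartsRed (drop i (replicate z true ++ R))
startsRed-drop-reds {zero}  {suc z} R _         = refl
startsRed-drop-reds {suc i} {suc z} R (s≤s i<z) = startsRed-drop-reds R i<z

beadWord-not-startsRed : ∀ ys → ¬ StartsRed (beadWord ys)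
beadWord-not-startsRed []      ()
beadWord-not-startsRed (y ∷ ys) ()

reds-cancel : ∀ y z {u v} → ¬ StartsRed u → ¬ StartsRed v →
  replicate y true ++ u ≡ replicate z true ++ v → y ≡ z × u ≡ v
reds-cancel zero    zero    _  _  eq = refl , eq
reds-cancel (suc y) zero    _  ¬v eq = ⊥-elim (¬v (sym (cong head eq)))
reds-cancel zero    (suc z) ¬u _  eq = ⊥-elim (¬u (cong head eq))
reds-cancel (suc y) (suc z) ¬u ¬v eq = map₁ (cong suc) (reds-cancel y z ¬u ¬v (∷-injectiveʳ eq))

beadWord-injective : ∀ ys zs → beadWord ys ≡ beadWord zs → ys ≡ zs
beadWord-injective []       []       _  = refl
beadWord-injective []       (_ ∷ _)  ()
beadWord-injective (_ ∷ _)  []       ()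
beadWord-injective (y ∷ ys) (z ∷ zs) eq
  with reds-cancel y z (beadWord-not-startsRed ys) (beadWord-not-startsRed zs) (∷-injectiveʳ eq)
... | refl , eq′ = cong (y ∷_) (beadWord-injective ys zs eq′)

length-beadWord-∷ : ∀ z zs → length (beadWord (z ∷ zs)) ≡ suc (z + length (beadWord zs))
length-beadWord-∷ z zs = cong suc (trans (length-++ (replicate z true)) (cong (_+ length (beadWord zs)) (length-replicate z)))

length-beadWord-∷ʳ : ∀ pre z → length (beadWord (pre ++ [ z ])) ≡ suc (length (beadWord pre) + z)
length-beadWord-∷ʳ pre z = begin
  length (beadWord (pre ++ [ z ]))        ≡⟨ cong length (concatMap-++ block pre [ z ]) ⟩
  length (beadWord pre ++ block z ++ [])  ≡⟨ length-++ (beadWord pre) ⟩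
  length (beadWord pre) + length (block z ++ [])
    ≡⟨ cong (λ n → length (beadWord pre) + suc n) (trans (cong length (++-identityʳ (replicate z true))) (length-replicate z)) ⟩
  length (beadWord pre) + suc z           ≡⟨ +-suc (length (beadWord pre)) z ⟩
  suc (length (beadWord pre) + z)         ∎
  where open ≡-Reasoning

rot : ∀ {A : Set} → ℕ → List A → List A
rot k w = drop k w ++ take k w

drop-length-++ : ∀ {A : Set} (p q : List A) n → drop (length p + n) (p ++ q) ≡ drop n q
drop-length-++ []      q n = refl
drop-length-++ (_ ∷ p) q n = drop-length-++ p q n

take-length-++ : ∀ {A : Set} (p q : List A) → take (length p) (p ++ q) ≡ p
take-length-++ []      q = refl
take-length-++ (a ∷ p) q = cong (a ∷_) (take-length-++ p q)

rot-length-++ : ∀ {A : Set} (p q : List A) → rot (length p) (p ++ q) ≡ q ++ p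
rot-length-++ p q = cong₂ _++_ (trans (cong (λ n → drop n (p ++ q)) (sym (+-identityʳ (length p))))
                                      (drop-length-++ p q 0))
                               (take-length-++ p q)

rot-map : ∀ {A B : Set} (f : A → B) s xs → rot s (map f xs) ≡ map f (rot s xs)
rot-map f s xs = trans (cong₂ _++_ (drop-map s xs) (take-map s xs)) (sym (map-++ f (drop s xs) (take s xs)))

rotate-at-boundary : ∀ pre zs →
  rotate (length (beadWord pre)) (beadWord (pre ++ zs)) ≡ beadWord (zs ++ pre)
rotate-at-boundary pre zs = begin
  rotate (length (beadWord pre)) (beadWord (pre ++ zs))        ≡⟨ cong (rotate (length (beadWord pre))) (concatMap-++ block pre zs) ⟩
  rotate (length (beadWord pre)) (beadWord pre ++ beadWord zs) ≡⟨ rot-length-++ (beadWord pre) (beadWord zs) ⟩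
  beadWord zs ++ beadWord pre                                  ≡⟨ concatMap-++ block zs pre ⟨
  beadWord (zs ++ pre)                                         ∎
  where open ≡-Reasoning

boundary-symmetry : ∀ pre zs →
  (rotate (length (beadWord pre)) (beadWord (pre ++ zs)) ≡ beadWord (pre ++ zs))
    ⇔ (rot (length pre) (pre ++ zs) ≡ pre ++ zs)
boundary-symmetry pre zs = mk⇔
  (λ fixed → trans (rot-length-++ pre zs)
                   (beadWord-injective _ _ (trans (sym (rotate-at-boundary pre zs)) fixed)))
  (λ fixed → trans (rotate-at-boundary pre zs)
                   (cong beadWord (trans (sym (rot-length-++ pre zs)) fixed)))

-- A rotation to a red bead (the (i+1)-th bead of the block of z) moves a red bead
-- to the front, so it cannot fix the bead word.
rotate-inside-block : ∀ pre z zs i → i < z →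
  rotate (suc (length (beadWord pre) + i)) (beadWord (pre ++ z ∷ zs)) ≢ beadWord (pre ++ z ∷ zs)
rotate-inside-block pre z zs i i<z fixed =
  beadWord-not-startsRed (pre ++ z ∷ zs) (subst StartsRed fixed (startsRed-++ _ _ front-red))
  where
  front-red : StartsRed (drop (suc (length (beadWord pre) + i)) (beadWord (pre ++ z ∷ zs)))
  front-red = subst StartsRed
    (sym (begin
      drop (suc (length (beadWord pre) + i)) (beadWord (pre ++ z ∷ zs))
        ≡⟨ cong₂ drop (sym (+-suc (length (beadWord pre)) i)) (concatMap-++ block pre (z ∷ zs)) ⟩
      drop (length (beadWord pre) + suc i) (beadWord pre ++ beadWord (z ∷ zs))
        ≡⟨ drop-length-++ (beadWord pre) (beadWord (z ∷ zs)) (suc i) ⟩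
      drop i (replicate z true ++ beadWord zs) ∎))
    (startsRed-drop-reds (beadWord zs) i<z)
    where open ≡-Reasoning

count : ∀ {P : ℕ → Set} → Decidable P → List ℕ → ℕ
count P? xs = length (filter P? xs)

count-++ : ∀ {P : ℕ → Set} (P? : Decidable P) xs ys → count P? (xs ++ ys) ≡ count P? xs + count P? ys
count-++ P? xs ys = trans (cong length (filter-++ P? xs ys)) (length-++ (filter P? xs))

count-∷ : ∀ {P Q : ℕ → Set} (P? : Decidable P) (Q? : Decidable Q) {o s xs ys} →
  P o ⇔ Q s → count P? xs ≡ count Q? ys → count P? (o ∷ xs) ≡ count Q? (s ∷ ys)
count-∷ P? Q? {o} {s} P⇔Q eq with P? o | Q? s
... | yes _  | yes _  = cong suc eq
... | no  _  | no  _  = eq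
... | yes p  | no ¬q  = ⊥-elim (¬q (Equivalence.to P⇔Q p))
... | no ¬p  | yes q  = ⊥-elim (¬p (Equivalence.from P⇔Q q))

interval : ℕ → ℕ → List ℕ
interval o zero    = []
interval o (suc m) = o ∷ interval (suc o) m

interval-+ : ∀ o m n → interval o (m + n) ≡ interval o m ++ interval (o + m) n
interval-+ o zero    n = cong (λ p → interval p n) (sym (+-identityʳ o))
interval-+ o (suc m) n = cong (o ∷_) (trans (interval-+ (suc o) m n)
                                            (cong (λ p → interval (suc o) m ++ interval p n) (sym (+-suc o m))))

applyUpTo-interval : ∀ (f : ℕ → ℕ) o n → (∀ i → f i ≡ o + i) → applyUpTo f n ≡ interval o n
applyUpTo-interval f o zero    f≡ = refl
applyUpTo-interval f o (suc n) f≡ = cong₂ _∷_ (trans (f≡ 0) (+-identityʳ o))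
  (applyUpTo-interval (λ i → f (suc i)) (suc o) n (λ i → trans (f≡ (suc i)) (+-suc o i)))

upTo-interval : ∀ n → upTo n ≡ interval 0 n
upTo-interval n = applyUpTo-interval id 0 n (λ _ → refl)

count-interval-none : ∀ {P : ℕ → Set} (P? : Decidable P) o m →
  (∀ i → i < m → ¬ P (o + i)) → count P? (interval o m) ≡ 0
count-interval-none P? o zero    none = refl
count-interval-none {P} P? o (suc m) none with P? o
... | yes p = ⊥-elim (none 0 (s≤s z≤n) (subst P (sym (+-identityʳ o)) p))
... | no  _ = count-interval-none P? (suc o) m
                (λ i i<m → subst (λ n → ¬ P n) (+-suc o i) (none (suc i) (s≤s i<m)))

fixedBy? : (ys : List ℕ) → Decidable (λ s → rot s ys ≡ ys)
fixedBy? ys s = ≡-dec _≟_ (rot s ys) ys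

seqRotCount : List ℕ → ℕ
seqRotCount ys = count (fixedBy? ys) (upTo (length ys))

-- Each block of z red beads contributes its black bead (boundary-symmetry) and no red
-- bead (rotate-inside-block).
rotations-of-suffix : ∀ {ys} pre zs → pre ++ zs ≡ ys →
  count (rotInvariant? (beadWord ys)) (interval (length (beadWord pre)) (length (beadWord zs)))
    ≡ count (fixedBy? ys) (interval (length pre) (length zs))
rotations-of-suffix pre []       _    = refl
rotations-of-suffix pre (z ∷ zs) refl = begin
  count W? (interval o (length (beadWord (z ∷ zs))))
    ≡⟨ cong (λ n → count W? (interval o n)) (length-beadWord-∷ z zs) ⟩
  count W? (o ∷ interval (suc o) (z + L))
    ≡⟨ count-∷ W? S? {o} {s} {xs = interval (suc o) (z + L)} {ys = interval (suc s) (length zs)}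
         (boundary-symmetry pre (z ∷ zs)) later-blocks ⟩
  count S? (s ∷ interval (suc s) (length zs)) ∎
  where
  open ≡-Reasoning
  W? = rotInvariant? (beadWord (pre ++ z ∷ zs))
  S? = fixedBy? (pre ++ z ∷ zs)
  o = length (beadWord pre)
  s = length pre
  L = length (beadWord zs)
  next-block : count W? (interval (suc (o + z)) L) ≡ count S? (interval (suc s) (length zs))
  next-block = subst₂ (λ o′ s′ → count W? (interval o′ L) ≡ count S? (interval s′ (length zs)))
    (length-beadWord-∷ʳ pre z) (trans (length-++ pre) (+-comm s 1))
    (rotations-of-suffix (pre ++ [ z ]) zs (++-assoc pre [ z ] zs))
  later-blocks : count W? (interval (suc o) (z + L)) ≡ count S? (interval (suc s) (length zs))
  later-blocks = begin
    count W? (interval (suc o) (z + L))                                       ≡⟨ cong (count W?) (interval-+ (suc o) z L) ⟩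
    count W? (interval (suc o) z ++ interval (suc (o + z)) L)                 ≡⟨ count-++ W? (interval (suc o) z) _ ⟩
    count W? (interval (suc o) z) + count W? (interval (suc (o + z)) L)
      ≡⟨ cong₂ _+_ (count-interval-none W? (suc o) z (rotate-inside-block pre z zs)) next-block ⟩
    count S? (interval (suc s) (length zs))                                   ∎

rotCount-beadWord : ∀ ys → rotCount (beadWord ys) ≡ seqRotCount ys
rotCount-beadWord ys = begin
  rotCount (beadWord ys)
    ≡⟨ cong (count (rotInvariant? (beadWord ys))) (upTo-interval (length (beadWord ys))) ⟩
  count (rotInvariant? (beadWord ys)) (interval 0 (length (beadWord ys)))
    ≡⟨ rotations-of-suffix [] ys refl ⟩
  count (fixedBy? ys) (interval 0 (length ys))
    ≡⟨ cong (count (fixedBy? ys)) (upTo-interval (length ys)) ⟨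
  seqRotCount ys ∎
  where open ≡-Reasoning

seqRotCount-map : ∀ (f g : ℕ → ℕ) ys → map g (map f ys) ≡ ys → seqRotCount ys ≡ seqRotCount (map f ys)
seqRotCount-map f g ys g∘f≡id = begin
  count (fixedBy? ys) (upTo (length ys))                 ≡⟨ cong length (filter-≐ (fixedBy? ys) (fixedBy? fys) ((λ {s} → to s) , (λ {s} → from s)) (upTo (length ys))) ⟩
  count (fixedBy? fys) (upTo (length ys))                ≡⟨ cong (λ n → count (fixedBy? fys) (upTo n)) (length-map f ys) ⟨
  count (fixedBy? fys) (upTo (length fys))               ∎
  where
  open ≡-Reasoning
  fys = map f ys
  to : ∀ s → rot s ys ≡ ys → rot s fys ≡ fys
  to s fixed = trans (rot-map f s ys) (cong (map f) fixed)
  from : ∀ s → rot s fys ≡ fys → rot s ys ≡ ys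
  from s fixed = begin
    rot s ys               ≡⟨ cong (rot s) g∘f≡id ⟨
    rot s (map g fys)      ≡⟨ rot-map g s fys ⟩
    map g (rot s fys)      ≡⟨ cong (map g) fixed ⟩
    map g fys              ≡⟨ g∘f≡id ⟩
    ys                     ∎

rotCount-∸ : ∀ b (x : Fin b → ℕ) (t : ℕ) → (∀ j → t ≤ x j) →
  rotCount (necklace b x) ≡ rotCount (necklace b (λ j → x j ∸ t))
rotCount-∸ b x t t≤x = begin
  rotCount (necklace b x)                                ≡⟨ cong rotCount (necklace-beadWord b x) ⟩
  rotCount (beadWord ys)                                 ≡⟨ rotCount-beadWord ys ⟩
  seqRotCount ys                                         ≡⟨ seqRotCount-map (_∸ t) (_+ t) ys add-back ⟩
  seqRotCount (map (_∸ t) ys)                            ≡⟨ rotCount-beadWord (map (_∸ t) ys) ⟨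
  rotCount (beadWord (map (_∸ t) ys))                    ≡⟨ cong (λ zs → rotCount (beadWord zs)) (map-∘ (allFin b)) ⟨
  rotCount (beadWord (map (λ j → x j ∸ t) (allFin b)))   ≡⟨ cong rotCount (necklace-beadWord b (λ j → x j ∸ t)) ⟨
  rotCount (necklace b (λ j → x j ∸ t))                  ∎
  where
  open ≡-Reasoning
  ys = map x (allFin b)
  add-back : map (_+ t) (map (_∸ t) ys) ≡ ys
  add-back = trans (sym (map-∘ ys)) (map-id-local (All.map⁺ (universal (λ j → m∸n+n≡m (t≤x j)) (allFin b))))

corollary1 : (a b : ℕ) .{{_ : NonZero a}} .{{_ : NonZero b}} (x : Fin b → ℕ) →
    charSum x ≡ a → Regular a b x →
    ((j : Fin b) → a / b ≤ x j)
    × charSum (λ j → x j ∸ a / b) ≡ a % b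
    × Regular (a % b) b (λ j → x j ∸ a / b)
    × rotCount (necklace b x) ≡ rotCount (necklace b (λ j → x j ∸ a / b))
corollary1 a b x Σx≡a regular = t≤x , Σx′≡r , regular′ , rotCount-∸ b x t t≤x
  where
  t = a / b
  r = a % b
  a≡r+t·b : a ≡ r + t * b
  a≡r+t·b = m≡m%n+[m/n]*n a b
  t≤x : (j : Fin b) → t ≤ x j
  t≤x = regular⇒quotient≤gap a b x regular
  Σx′≡r : charSum (λ j → x j ∸ t) ≡ r
  Σx′≡r = +-cancelʳ-≡ (t * b) (charSum (λ j → x j ∸ t)) r (begin
    charSum (λ j → x j ∸ t) + t * b ≡⟨ cong (charSum (λ j → x j ∸ t) +_) (*-comm t b) ⟩
    charSum (λ j → x j ∸ t) + b * t ≡⟨ charSum-∸ x t t≤x ⟩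
    charSum x                       ≡⟨ trans Σx≡a a≡r+t·b ⟩
    r + t * b                       ∎)
    where open ≡-Reasoning
  regular′ : Regular r b (λ j → x j ∸ t)
  regular′ = regular-∸ r t b x t≤x (subst (λ n → Regular n b x) a≡r+t·b regular)
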